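{- Let $H$ be a connected graph which contains a triangle, and let $u$ be a vertex of $H$. Let $M$ be a unicyclic graph with unique cycle $C$, and let $U$ be the set of vertices of $M$ at distance exactly $r$ from $C$, where $r\geq |V(H)|+3$. Then there is a homomorphism from $M$ to $H$ which maps every vertex of $U$ to $u$.
   Context: A homomorphism from a graph $M$ to a graph $H$ is a map $h:V(M)\to V(H)$ such that for every edge $xy$ of $M$, $h(x)h(y)$ is an edge of $H$. A graph is unicyclic if it has exactly one cycle. The distance from a vertex to a set of vertices is the minimum graph distance to a vertex of the set. -}

module Defs where

open import Data.Nat using (ℕ; zero; suc; _≤_; _<_; _∸_)
open import Data.Fin using (Fin; toℕ)
open import Data.Bool using (Bool; true; false)
open import Data.Product using (Σ; ∃; ∃-syntax; _×_; _,_)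
open import Data.Sum using (_⊎_)
open import Function.Definitions using (Injective)
open import Function.Bundles using (_⇔_)
open import Relation.Binary.PropositionalEquality using (_≡_)

record Graph : Set where
  field
    size  : ℕ
    adj   : Fin size → Fin size → Bool
    sym   : ∀ x y → adj x y ≡ adj y x
    irref : ∀ x → adj x x ≡ false

open Graph public

V : Graph → Set
V G = Fin (size G)

Edge : (G : Graph) → V G → V G → Set
Edge G x y = adj G x y ≡ true

data Walk (G : Graph) : V G → V G → ℕ → Set where
  here : ∀ {x} → Walk G x x zero
  step : ∀ {x y z ℓ} → Edge G x y → Walk G y z ℓ → Walk G x z (suc ℓ)

Connected : Graph → Set
Connected G = ∀ (x y : V G) → ∃[ ℓ ] Walk G x y ℓ

HasTriangle : Graph → Set
HasTriangle G = ∃[ a ] ∃[ b ] ∃[ c ] (Edge G a b × Edge G b c × Edge G a c)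

CyclicSucc : {k : ℕ} → Fin k → Fin k → Set
CyclicSucc {k} i j = (toℕ j ≡ suc (toℕ i)) ⊎ ((toℕ i ≡ k ∸ 1) × (toℕ j ≡ 0))

record Cycle (G : Graph) : Set where
  field
    len      : ℕ
    len≥3    : 3 ≤ len
    vert     : Fin len → V G
    distinct : Injective _≡_ _≡_ vert
    closed   : ∀ i j → CyclicSucc i j → Edge G (vert i) (vert j)

open Cycle public

CycleEdge : {G : Graph} → Cycle G → V G → V G → Set
CycleEdge C x y = ∃[ i ] ∃[ j ] (CyclicSucc i j ×
  (((vert C i ≡ x) × (vert C j ≡ y)) ⊎ ((vert C i ≡ y) × (vert C j ≡ x))))

OnCycle : {G : Graph} → Cycle G → V G → Set
OnCycle C x = ∃[ i ] vert C i ≡ x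

-- Cycles are identified with their edge sets (as subgraphs).
SameCycle : {G : Graph} → Cycle G → Cycle G → Set
SameCycle C D = ∀ x y → CycleEdge C x y ⇔ CycleEdge D x y

UniqueCycle : (G : Graph) → Cycle G → Set
UniqueCycle G C = ∀ (D : Cycle G) → SameCycle C D

DistToCycle : {G : Graph} → V G → Cycle G → ℕ → Set
DistToCycle {G} v C r =
  (∃[ s ] (OnCycle C s × Walk G v s r)) ×
  (∀ s ℓ → OnCycle C s → Walk G v s ℓ → r ≤ ℓ)

Hom : Graph → Graph → Set
Hom M H = Σ (V M → V H) λ h → ∀ x y → Edge M x y → Edge H (h x) (h y)

module Submission where

-- Layer M by depth, the distance to the anchors: the vertices of C
-- together with one root in each component of M missing C.  As C is the only
-- cycle, an edge joins vertices of equal depth only on C (chains descending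
-- from both ends to the anchors would otherwise bypass it and close a second
-- cycle), and a depth-1 vertex has its anchor as its only depth-0 neighbour.
-- Depth-0 vertices go to the triangle by a proper 3-colouring of C, a depth-1
-- vertex to a corner adjacent to its anchor's image and to c, and a vertex of
-- depth k + 2 to step k of an infinite walk from c that is at u at step r − 2;
-- it exists because the triangle lets closed walks at c have any length ≥ 2.

open import Defs
open import Data.Nat using (ℕ; zero; suc; _+_; _∸_; _≤_; _<_; z≤n; s≤s; z<s; _<?_; _≤?_)
open import Data.Nat.Properties
open import Data.Fin using (Fin; toℕ; fromℕ<; fromℕ) renaming (zero to fzero; suc to fsuc)
open import Data.Fin.Properties
  using (toℕ-injective; toℕ<n; any?; all?; injective⇒≤; toℕ-fromℕ<; toℕ-fromℕ)
  renaming (_≟_ to _≟F_)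
open import Data.Bool using (true) renaming (_≟_ to _≟B_)
open import Data.Product using (Σ; ∃; _×_; _,_; proj₁; proj₂)
open import Data.Sum using (_⊎_; inj₁; inj₂)
open import Relation.Nullary using (¬_; Dec; yes; no; contradiction)
open import Relation.Nullary.Decidable using (_×-dec_; _⊎-dec_; _→-dec_; ¬?)
open import Relation.Binary.PropositionalEquality
  using (_≡_; _≢_; refl; cong; subst; subst₂; trans; module ≡-Reasoning) renaming (sym to ≡-sym)
open import Function using (flip; _∘_)
open import Function.Bundles using (Equivalence)
open import Relation.Binary.Definitions using (tri<; tri≈; tri>)

-- Finite paths are handled as sequences p : ℕ → A of which only the first
-- ℓ steps matter.  This representation makes splicing, reversal and the
-- removal of repeated entries (loop erasure) simple index arithmetic.
module Sequences {A : Set} where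

  Steps : (A → A → Set) → ℕ → (ℕ → A) → Set
  Steps Q ℓ p = ∀ i → i < ℓ → Q (p i) (p (suc i))

  record Chain (Q : A → A → Set) (a b : A) : Set where
    constructor chain
    field
      length : ℕ
      entry  : ℕ → A
      start  : entry 0 ≡ a
      end    : entry length ≡ b
      steps  : Steps Q length entry

  Distinct : ℕ → (ℕ → A) → Set
  Distinct ℓ p = ∀ i j → i ≤ ℓ → j ≤ ℓ → p i ≡ p j → i ≡ j

  steps-≤ : ∀ {Q ℓ m p} → m ≤ ℓ → Steps Q ℓ p → Steps Q m p
  steps-≤ m≤ℓ st i i<m = st i (<-≤-trans i<m m≤ℓ)

  splice : ℕ → (ℕ → A) → (ℕ → A) → ℕ → A
  splice ℓ p q k with k <? ℓ
  ... | yes _ = p k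
  ... | no _ = q (k ∸ ℓ)

  splice-< : ∀ {ℓ p q k} → k < ℓ → splice ℓ p q k ≡ p k
  splice-< {ℓ} {k = k} k<ℓ with k <? ℓ
  ... | yes _ = refl
  ... | no k≮ℓ = contradiction k<ℓ k≮ℓ

  splice-≥ : ∀ {ℓ p q k} → ℓ ≤ k → splice ℓ p q k ≡ q (k ∸ ℓ)
  splice-≥ {ℓ} {k = k} ℓ≤k with k <? ℓ
  ... | yes k<ℓ = contradiction ℓ≤k (<⇒≱ k<ℓ)
  ... | no _ = refl

  splice-start : ∀ {ℓ p q} → p ℓ ≡ q 0 → splice ℓ p q 0 ≡ p 0
  splice-start {zero} {p} {q} join = trans (splice-≥ {zero} {p} {q} z≤n) (≡-sym join)
  splice-start {suc ℓ} {p} {q} _ = splice-< {suc ℓ} {p} {q} z<s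

  splice-end : ∀ {ℓ p q} m → splice ℓ p q (ℓ + m) ≡ q m
  splice-end {ℓ} {p} {q} m = trans (splice-≥ {ℓ} {p} {q} (m≤m+n ℓ m)) (cong q (m+n∸m≡n ℓ m))

  lt-or-ge : ∀ i ℓ → i < ℓ ⊎ ℓ ≤ i
  lt-or-ge i ℓ with i <? ℓ
  ... | yes i<ℓ = inj₁ i<ℓ
  ... | no i≮ℓ = inj₂ (≮⇒≥ i≮ℓ)

  splice-steps : ∀ {Q ℓ m p q} → p ℓ ≡ q 0 → Steps Q ℓ p → Steps Q m q →
                 Steps Q (ℓ + m) (splice ℓ p q)
  splice-steps {Q} {ℓ} {m} {p} {q} join sp sq i i<ℓ+m with lt-or-ge i ℓ
  ... | inj₁ i<ℓ = subst₂ Q (≡-sym (splice-< {ℓ} {p} {q} i<ℓ)) (≡-sym next) (sp i i<ℓ)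
    where
    next : splice ℓ p q (suc i) ≡ p (suc i)
    next with m≤n⇒m<n∨m≡n i<ℓ
    ... | inj₁ 1+i<ℓ = splice-< {ℓ} {p} {q} 1+i<ℓ
    ... | inj₂ refl = trans (splice-≥ {ℓ} {p} {q} ≤-refl) (trans (cong q (n∸n≡0 ℓ)) (≡-sym join))
  ... | inj₂ ℓ≤i =
        subst₂ Q (≡-sym (splice-≥ {ℓ} {p} {q} ℓ≤i)) (≡-sym next) (sq (i ∸ ℓ) i∸ℓ<m)
    where
    next : splice ℓ p q (suc i) ≡ q (suc (i ∸ ℓ))
    next = trans (splice-≥ {ℓ} {p} {q} (m≤n⇒m≤1+n ℓ≤i)) (cong q (+-∸-assoc 1 ℓ≤i))
    i∸ℓ<m : i ∸ ℓ < m
    i∸ℓ<m = subst (i ∸ ℓ <_) (m+n∸m≡n ℓ m) (∸-monoˡ-< i<ℓ+m ℓ≤i)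

  shift : (ℕ → A) → ℕ → ℕ → A
  shift p j k = p (j + k)

  shift-steps : ∀ {Q ℓ p j} → j ≤ ℓ → Steps Q ℓ p → Steps Q (ℓ ∸ j) (shift p j)
  shift-steps {Q} {ℓ} {p} {j} j≤ℓ st i i<ℓ∸j = subst (λ k → Q (p (j + i)) (p k)) (≡-sym (+-suc j i))
    (st (j + i) (subst (j + i <_) (m+[n∸m]≡n j≤ℓ) (+-monoʳ-< j i<ℓ∸j)))

  chain-++ : ∀ {Q a b c} → Chain Q a b → Chain Q b c → Chain Q a c
  chain-++ {Q} (chain ℓ p p0 pℓ sp) (chain m q q0 qm sq) =
    chain (ℓ + m) (splice ℓ p q) (trans (splice-start {ℓ} {p} {q} join) p0)
      (trans (splice-end {ℓ} {p} {q} m) qm) (splice-steps {Q} {ℓ} {m} {p} {q} join sp sq)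
    where join = trans pℓ (≡-sym q0)

  chain-reverse : ∀ {Q a b} → Chain Q a b → Chain (flip Q) b a
  chain-reverse {Q} (chain ℓ p p0 pℓ st) =
    chain ℓ (λ k → p (ℓ ∸ k)) pℓ (trans (cong p (n∸n≡0 ℓ)) p0) reversed
    where
    reversed : Steps (flip Q) ℓ (λ k → p (ℓ ∸ k))
    reversed i i<ℓ = subst (λ k → Q (p (ℓ ∸ suc i)) (p k)) (≡-sym (+-∸-assoc 1 i<ℓ))
                       (st (ℓ ∸ suc i) (∸-monoʳ-< z<s i<ℓ))

  chain-map : ∀ {Q Q′ a b} → (∀ {x y} → Q x y → Q′ x y) → Chain Q a b → Chain Q′ a b
  chain-map f (chain ℓ p p0 pℓ st) = chain ℓ p p0 pℓ λ i i<ℓ → f (st i i<ℓ)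

  chain-refl : ∀ {Q a} → Chain Q a a
  chain-refl {a = a} = chain 0 (λ _ → a) refl refl λ _ ()

  chain-single : ∀ {Q a b} → Q a b → Chain Q a b
  chain-single {a = a} {b} qab =
    chain 1 (λ { zero → a ; (suc _) → b }) refl refl λ { zero _ → qab ; (suc _) (s≤s ()) }

module LeastNumber {P : ℕ → Set} (P? : ∀ n → Dec (P n)) where

  Least : ℕ → Set
  Least k = P k × (∀ j → j < k → ¬ P j)

  leastBelow : ∀ n → (∃ λ k → k < n × Least k) ⊎ (∀ j → j < n → ¬ P j)
  leastBelow zero = inj₂ λ _ ()
  leastBelow (suc n) with leastBelow n
  ... | inj₁ (k , k<n , least) = inj₁ (k , m<n⇒m<1+n k<n , least)
  ... | inj₂ none with P? n
  ...   | yes pn = inj₁ (n , ≤-refl , pn , none)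
  ...   | no ¬pn = inj₂ noneUpTo
    where
    noneUpTo : ∀ j → j < suc n → ¬ P j
    noneUpTo j j<1+n with m<1+n⇒m<n∨m≡n j<1+n
    ... | inj₁ j<n = none j j<n
    ... | inj₂ refl = ¬pn

  least : ∀ {n} → P n → ∃ Least
  least {n} pn with leastBelow (suc n)
  ... | inj₁ (k , _ , leastk) = k , leastk
  ... | inj₂ none = contradiction pn (none n ≤-refl)

-- Loop erasure: a Q-path with a repeated entry can be shortcut, so every
-- Q-path can be replaced by one with pairwise distinct entries and the same
-- endpoints.  (Used for walks in a graph and for cycle detection.)
module LoopErasure {A : Set} (_≟_ : (a b : A) → Dec (a ≡ b)) where
  open Sequences {A}

  repetitionOrDistinct : (p : ℕ → A) (ℓ : ℕ) →
    (∃ λ i → ∃ λ j → i < j × j ≤ ℓ × p i ≡ p j) ⊎ Distinct ℓ p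
  repetitionOrDistinct p zero = inj₂ λ { zero zero _ _ _ → refl ; (suc _) _ () _ _ ; zero (suc _) _ () _ }
  repetitionOrDistinct p (suc ℓ) with repetitionOrDistinct p ℓ
  ... | inj₁ (i , j , i<j , j≤ℓ , pi≡pj) = inj₁ (i , j , i<j , m≤n⇒m≤1+n j≤ℓ , pi≡pj)
  ... | inj₂ distinct with anyUpTo? (λ i → p i ≟ p (suc ℓ)) (suc ℓ)
  ...   | yes (i , i<1+ℓ , pi≡) = inj₁ (i , suc ℓ , i<1+ℓ , ≤-refl , pi≡)
  ...   | no fresh = inj₂ λ i j i≤ j≤ e → cases (m≤n⇒m<n∨m≡n i≤) (m≤n⇒m<n∨m≡n j≤) e
    where
    cases : ∀ {i j} → i < suc ℓ ⊎ i ≡ suc ℓ → j < suc ℓ ⊎ j ≡ suc ℓ → p i ≡ p j → i ≡ j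
    cases (inj₁ i<) (inj₁ j<) e = distinct _ _ (≤-pred i<) (≤-pred j<) e
    cases (inj₁ i<) (inj₂ refl) e = contradiction (_ , i< , e) fresh
    cases (inj₂ refl) (inj₁ j<) e = contradiction (_ , j< , ≡-sym e) fresh
    cases (inj₂ refl) (inj₂ refl) _ = refl

  Erased : (A → A → Set) → ℕ → (ℕ → A) → Set
  Erased Q ℓ p = Σ ℕ λ ℓ′ → Σ (ℕ → A) λ p′ →
    p′ 0 ≡ p 0 × p′ ℓ′ ≡ p ℓ × Steps Q ℓ′ p′ × Distinct ℓ′ p′ × ℓ′ ≤ ℓ

  cutLoop : ∀ {Q ℓ p i j} → i < j → j ≤ ℓ → p i ≡ p j → Steps Q ℓ p →
    Σ ℕ λ ℓ′ → ℓ′ < ℓ × Σ (ℕ → A) λ p′ → p′ 0 ≡ p 0 × p′ ℓ′ ≡ p ℓ × Steps Q ℓ′ p′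
  cutLoop {Q} {ℓ} {p} {i} {j} i<j j≤ℓ pi≡pj st =
    i + (ℓ ∸ j) , shorter , splice i p (shift p j) ,
    splice-start {i} {p} {shift p j} join ,
    trans (splice-end {i} {p} {shift p j} (ℓ ∸ j)) (cong p (m+[n∸m]≡n j≤ℓ)) ,
    splice-steps {Q} {i} {ℓ ∸ j} {p} {shift p j} join
      (steps-≤ {Q} {ℓ} {i} {p} (<⇒≤ (<-≤-trans i<j j≤ℓ)) st) (shift-steps {Q} {ℓ} {p} {j} j≤ℓ st)
    where
    join : p i ≡ shift p j 0
    join = trans pi≡pj (cong p (≡-sym (+-identityʳ j)))
    shorter : i + (ℓ ∸ j) < ℓ
    shorter = subst (i + (ℓ ∸ j) <_) (m+[n∸m]≡n j≤ℓ) (+-monoˡ-< (ℓ ∸ j) i<j)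

  -- Repeatedly cut loops; the length strictly decreases, bounded by the fuel.
  eraseWithin : ∀ {Q} fuel ℓ p → ℓ < fuel → Steps Q ℓ p → Erased Q ℓ p
  eraseWithin {Q} (suc fuel) ℓ p ℓ<fuel st with repetitionOrDistinct p ℓ
  ... | inj₂ distinct = ℓ , p , refl , refl , st , distinct , ≤-refl
  ... | inj₁ (i , j , i<j , j≤ℓ , pi≡pj) with cutLoop {Q} {ℓ} {p} i<j j≤ℓ pi≡pj st
  ...   | ℓ₁ , ℓ₁<ℓ , p₁ , start , end , st₁
          with eraseWithin {Q} fuel ℓ₁ p₁ (<-≤-trans ℓ₁<ℓ (≤-pred ℓ<fuel)) st₁
  ...     | ℓ′ , p′ , start′ , end′ , st′ , distinct , ℓ′≤ℓ₁ =
            ℓ′ , p′ , trans start′ start , trans end′ end , st′ , distinct ,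
            ≤-trans ℓ′≤ℓ₁ (<⇒≤ ℓ₁<ℓ)

  erase : ∀ {Q} ℓ p → Steps Q ℓ p → Erased Q ℓ p
  erase {Q} ℓ p = eraseWithin {Q} (suc ℓ) ℓ p ≤-refl

module GraphFacts (G : Graph) where
  open Sequences {V G}
  open LoopErasure {V G} _≟F_

  edge-sym : ∀ {x y} → Edge G x y → Edge G y x
  edge-sym {x} {y} exy = trans (Graph.sym G y x) exy

  edge-irrefl : ∀ {x y} → Edge G x y → x ≢ y
  edge-irrefl {x} exx refl with trans (≡-sym exx) (irref G x)
  ... | ()

  edge? : ∀ x y → Dec (Edge G x y)
  edge? x y = adj G x y ≟B true

  walk→steps : ∀ {x y ℓ} → Walk G x y ℓ →
    Σ (ℕ → V G) λ p → p 0 ≡ x × p ℓ ≡ y × Steps (Edge G) ℓ p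
  walk→steps {x} here = (λ _ → x) , refl , refl , λ _ ()
  walk→steps {x} (step exz w) with walk→steps w
  ... | p , p0 , pℓ , st = p′ , refl , pℓ , st′
    where
    p′ : ℕ → V G
    p′ zero = x
    p′ (suc k) = p k
    st′ : Steps (Edge G) _ p′
    st′ zero _ = subst (Edge G x) (≡-sym p0) exz
    st′ (suc i) (s≤s i<ℓ) = st i i<ℓ

  steps→walk : ∀ {ℓ p a b} → Steps (Edge G) ℓ p → p 0 ≡ a → p ℓ ≡ b → Walk G a b ℓ
  steps→walk {zero} {p} st refl refl = here
  steps→walk {suc ℓ} {p} st refl refl =
    step (st 0 z<s) (steps→walk {ℓ} {p ∘ suc} (λ i i<ℓ → st (suc i) (s≤s i<ℓ)) refl refl)

  _++ʷ_ : ∀ {x y z ℓ m} → Walk G x y ℓ → Walk G y z m → Walk G x z (ℓ + m)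
  here ++ʷ w = w
  step e v ++ʷ w = step e (v ++ʷ w)

  reverseʷ : ∀ {x y ℓ} → Walk G x y ℓ → Walk G y x ℓ
  reverseʷ here = here
  reverseʷ {ℓ = suc ℓ} (step e w) =
    subst (Walk G _ _) (+-comm ℓ 1) (reverseʷ w ++ʷ step (edge-sym e) here)

  distinct-bound : ∀ {ℓ p} → Distinct ℓ p → ℓ < size G
  distinct-bound {ℓ} {p} distinct = injective⇒≤ {f = p ∘ toℕ} injective
    where
    injective : ∀ {i j : Fin (suc ℓ)} → p (toℕ i) ≡ p (toℕ j) → i ≡ j
    injective {i} {j} e = toℕ-injective (distinct _ _ (≤-pred (toℕ<n i)) (≤-pred (toℕ<n j)) e)

  shortWalk : ∀ {x y ℓ} → Walk G x y ℓ → ∃ λ ℓ′ → ℓ′ < size G × Walk G x y ℓ′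
  shortWalk w with walk→steps w
  ... | p , p0 , pℓ , st with erase {Edge G} _ p st
  ...   | ℓ′ , p′ , start , end , st′ , distinct , _ =
          ℓ′ , distinct-bound distinct , steps→walk st′ (trans start p0) (trans end pℓ)

  WalkTo : (V G → Set) → ℕ → V G → Set
  WalkTo P ℓ v = ∃ λ s → P s × Walk G v s ℓ

  walkTo? : {P : V G → Set} → (∀ v → Dec (P v)) → ∀ ℓ v → Dec (WalkTo P ℓ v)
  walkTo? P? zero v with P? v
  ... | yes pv = yes (v , pv , here)
  ... | no ¬pv = no λ { (_ , ps , here) → ¬pv ps }
  walkTo? P? (suc ℓ) v with any? (λ w → edge? v w ×-dec walkTo? P? ℓ w)
  ... | yes (w , e , s , ps , walk) = yes (s , ps , step e walk)
  ... | no none = no λ { (s , ps , step {y = w} e walk) → none (w , e , s , ps , walk) }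

  Reach : V G → V G → Set
  Reach x y = ∃ λ ℓ → Walk G x y ℓ

  -- Reachability is decidable: only walks shorter than |V G| need checking.
  reach? : ∀ x y → Dec (Reach x y)
  reach? x y with anyUpTo? (λ ℓ → walkTo? (_≟F y) ℓ x) (size G)
  ... | yes (ℓ , _ , _ , refl , w) = yes (ℓ , w)
  ... | no none = no λ (_ , w) →
          let (ℓ′ , ℓ′< , w′) = shortWalk w in none (ℓ′ , ℓ′< , y , refl , w′)

  reach-trans : ∀ {x y z} → Reach x y → Reach y z → Reach x z
  reach-trans (_ , v) (_ , w) = _ , v ++ʷ w

  reach-sym : ∀ {x y} → Reach x y → Reach y x
  reach-sym (_ , w) = _ , reverseʷ w

  reach-edge : ∀ {x y} → Edge G x y → Reach x y
  reach-edge e = 1 , step e here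

  chain→reach : ∀ {Q a b} → (∀ {x y} → Q x y → Edge G x y) → Chain Q a b → Reach a b
  chain→reach toEdge (chain ℓ p p0 pℓ st) = ℓ , steps→walk (λ i i<ℓ → toEdge (st i i<ℓ)) p0 pℓ

  pathCycle : ∀ m p → Distinct (2 + m) p → Steps (Edge G) (2 + m) p → Edge G (p (2 + m)) (p 0) → Cycle G
  pathCycle m p distinct st closing = record
    { len = 3 + m
    ; len≥3 = s≤s (s≤s (s≤s z≤n))
    ; vert = p ∘ toℕ
    ; distinct = λ {i} {j} e → toℕ-injective (distinct _ _ (≤-pred (toℕ<n i)) (≤-pred (toℕ<n j)) e)
    ; closed = closed′
    }
    where
    closed′ : ∀ i j → CyclicSucc i j → Edge G (p (toℕ i)) (p (toℕ j))
    closed′ i j (inj₁ j≡1+i) =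
      subst (Edge G (p (toℕ i)) ∘ p) (≡-sym j≡1+i)
        (st (toℕ i) (subst (_≤ 2 + m) j≡1+i (≤-pred (toℕ<n j))))
    closed′ i j (inj₂ (i≡last , j≡0)) =
      subst₂ (λ k l → Edge G (p k) (p l)) (≡-sym i≡last) (≡-sym j≡0) closing

  pathCycle-closing : ∀ m p distinct st closing →
    CycleEdge (pathCycle m p distinct st closing) (p (2 + m)) (p 0)
  pathCycle-closing m p _ _ _ =
    fromℕ (2 + m) , fzero , inj₂ (toℕ-fromℕ (2 + m) , refl) , inj₁ (cong p (toℕ-fromℕ (2 + m)) , refl)

  Ray : (ℕ → V G) → Set
  Ray p = ∀ i → Edge G (p i) (p (suc i))

  _▹_ : ∀ {x y ℓ} → Walk G x y ℓ → (ℕ → V G) → ℕ → V G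
  (here ▹ p) i = p i
  (step {x} _ _ ▹ p) zero = x
  (step _ w ▹ p) (suc i) = (w ▹ p) i

  ▹-start : ∀ {x y ℓ p} (w : Walk G x y ℓ) → p 0 ≡ y → (w ▹ p) 0 ≡ x
  ▹-start here p0 = p0
  ▹-start (step _ _) _ = refl

  ▹-end : ∀ {x y ℓ p} (w : Walk G x y ℓ) → (w ▹ p) ℓ ≡ p 0
  ▹-end here = refl
  ▹-end (step _ w) = ▹-end w

  ▹-ray : ∀ {x y ℓ p} (w : Walk G x y ℓ) → p 0 ≡ y → Ray p → Ray (w ▹ p)
  ▹-ray here _ ray = ray
  ▹-ray {p = p} (step e w) p0 ray zero = subst (Edge G _) (≡-sym (▹-start {p = p} w p0)) e
  ▹-ray (step _ w) p0 ray (suc i) = ▹-ray w p0 ray i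

  oscillate : V G → V G → ℕ → V G
  oscillate x y zero = x
  oscillate x y (suc i) = oscillate y x i

  oscillate-ray : ∀ {x y} → Edge G x y → Ray (oscillate x y)
  oscillate-ray exy zero = exy
  oscillate-ray exy (suc i) = oscillate-ray (edge-sym exy) i

-- Colours 0, 1, 2; colour 2 is reserved for the corner c of the triangle.
two : Fin 3
two = fsuc (fsuc fzero)

other : Fin 3 → Fin 3
other fzero = fsuc fzero
other (fsuc _) = fzero

other-≢ : ∀ t → other t ≢ t
other-≢ fzero ()
other-≢ (fsuc _) ()

other-≢-two : ∀ t → other t ≢ two
other-≢-two fzero ()
other-≢-two (fsuc _) ()

module CycleColouring (k : ℕ) (3≤k : 3 ≤ k) where

  alternate : ℕ → Fin 3
  alternate zero = fzero
  alternate (suc zero) = fsuc fzero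
  alternate (suc (suc n)) = alternate n

  alternate-≢-next : ∀ n → alternate n ≢ alternate (suc n)
  alternate-≢-next zero ()
  alternate-≢-next (suc zero) ()
  alternate-≢-next (suc (suc n)) = alternate-≢-next n

  alternate-≢-two : ∀ n → alternate n ≢ two
  alternate-≢-two zero ()
  alternate-≢-two (suc zero) ()
  alternate-≢-two (suc (suc n)) = alternate-≢-two n

  Last : Fin k → Set
  Last i = toℕ i ≡ k ∸ 1

  colour : Fin k → Fin 3
  colour i with toℕ i ≟ k ∸ 1
  ... | yes _ = two
  ... | no _ = alternate (toℕ i)

  colour-last : ∀ {i} → Last i → colour i ≡ two
  colour-last {i} last with toℕ i ≟ k ∸ 1
  ... | yes _ = refl
  ... | no ¬last = contradiction last ¬last

  colour-inner : ∀ {i} → ¬ Last i → colour i ≡ alternate (toℕ i)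
  colour-inner {i} ¬last with toℕ i ≟ k ∸ 1
  ... | yes last = contradiction last ¬last
  ... | no _ = refl

  last-or-not : ∀ i → Last i ⊎ ¬ Last i
  last-or-not i with toℕ i ≟ k ∸ 1
  ... | yes last = inj₁ last
  ... | no ¬last = inj₂ ¬last

  1+[k∸1]≡k : suc (k ∸ 1) ≡ k
  1+[k∸1]≡k = m+[n∸m]≡n {1} {k} (≤-trans (s≤s z≤n) 3≤k)

  first-not-last : ∀ {j : Fin k} → toℕ j ≡ 0 → ¬ Last j
  first-not-last {j} j≡0 last
    with subst (3 ≤_) (trans (≡-sym 1+[k∸1]≡k) (cong suc (trans (≡-sym last) j≡0))) 3≤k
  ... | s≤s ()

  colour-proper : ∀ i j → CyclicSucc i j → colour i ≢ colour j
  colour-proper i j (inj₂ (last , j≡0)) same = alternate-≢-two 0 (begin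
      alternate 0          ≡⟨ cong alternate (≡-sym j≡0) ⟩
      alternate (toℕ j)    ≡⟨ ≡-sym (colour-inner (first-not-last j≡0)) ⟩
      colour j             ≡⟨ ≡-sym same ⟩
      colour i             ≡⟨ colour-last last ⟩
      two                  ∎)
    where open ≡-Reasoning
  colour-proper i j (inj₁ j≡1+i) same with last-or-not i | last-or-not j
  ... | inj₁ last | _ =
    <-irrefl refl (subst (_< k) (trans j≡1+i (trans (cong suc last) 1+[k∸1]≡k)) (toℕ<n j))
  ... | inj₂ ¬lastᵢ | inj₁ lastⱼ =
    alternate-≢-two (toℕ i) (trans (≡-sym (colour-inner ¬lastᵢ)) (trans same (colour-last lastⱼ)))
  ... | inj₂ ¬lastᵢ | inj₂ ¬lastⱼ = alternate-≢-next (toℕ i) (begin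
      alternate (toℕ i)        ≡⟨ ≡-sym (colour-inner ¬lastᵢ) ⟩
      colour i                 ≡⟨ same ⟩
      colour j                 ≡⟨ colour-inner ¬lastⱼ ⟩
      alternate (toℕ j)        ≡⟨ cong alternate j≡1+i ⟩
      alternate (suc (toℕ i))  ∎)
    where open ≡-Reasoning

module TriangleTarget (H : Graph) (tri : HasTriangle H) where
  open GraphFacts H

  a b c : V H
  a = proj₁ tri
  b = proj₁ (proj₂ tri)
  c = proj₁ (proj₂ (proj₂ tri))

  eab : Edge H a b
  eab = proj₁ (proj₂ (proj₂ (proj₂ tri)))
  ebc : Edge H b c
  ebc = proj₁ (proj₂ (proj₂ (proj₂ (proj₂ tri))))
  eac : Edge H a c
  eac = proj₂ (proj₂ (proj₂ (proj₂ (proj₂ tri))))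

  corner : Fin 3 → V H
  corner fzero = a
  corner (fsuc fzero) = b
  corner (fsuc (fsuc fzero)) = c

  corner-edge : ∀ s t → s ≢ t → Edge H (corner s) (corner t)
  corner-edge fzero fzero s≢t = contradiction refl s≢t
  corner-edge fzero (fsuc fzero) _ = eab
  corner-edge fzero (fsuc (fsuc fzero)) _ = eac
  corner-edge (fsuc fzero) fzero _ = edge-sym eab
  corner-edge (fsuc fzero) (fsuc fzero) s≢t = contradiction refl s≢t
  corner-edge (fsuc fzero) (fsuc (fsuc fzero)) _ = ebc
  corner-edge (fsuc (fsuc fzero)) fzero _ = edge-sym eac
  corner-edge (fsuc (fsuc fzero)) (fsuc fzero) _ = edge-sym ebc
  corner-edge (fsuc (fsuc fzero)) (fsuc (fsuc fzero)) s≢t = contradiction refl s≢t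

  -- Closed walks at c of every length at least 2: the even ones go back and
  -- forth along ca, the odd ones also go once around the triangle.
  closedWalk : ∀ n → Walk H c c (2 + n)
  closedWalk zero = step (edge-sym eac) (step eac here)
  closedWalk (suc zero) = step (edge-sym eac) (step eab (step ebc here))
  closedWalk (suc (suc n)) = step (edge-sym eac) (step eac (closedWalk n))

  module _ (conn : Connected H) where

    -- Since the triangle makes the graph non-bipartite, every vertex is
    -- reached from c by a walk of every length m > |V H|: a short walk
    -- preceded by a closed walk of the missing length.
    exactWalk : ∀ u m → size H < m → Walk H c u m
    exactWalk u m |H|<m with shortWalk (proj₂ (conn c u))
    ... | ℓ , ℓ<|H| , w = subst (Walk H c u) length (closedWalk n ++ʷ w)
      where
      n = m ∸ (2 + ℓ)
      length : 2 + n + ℓ ≡ m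
      length = begin
        2 + n + ℓ     ≡⟨ +-assoc 2 n ℓ ⟩
        2 + (n + ℓ)   ≡⟨ cong (2 +_) (+-comm n ℓ) ⟩
        2 + ℓ + n     ≡⟨ m+[n∸m]≡n (<-≤-trans (s≤s ℓ<|H|) |H|<m) ⟩
        m             ∎
        where open ≡-Reasoning

    neighbour : ∀ u → ∃ (Edge H u)
    neighbour u with conn u a
    ... | _ , step e _ = _ , e
    ... | _ , here = b , eab

    rayThrough : ∀ u m → size H < m →
      Σ (ℕ → V H) λ q → q 0 ≡ c × q m ≡ u × Ray q
    rayThrough u m |H|<m =
      exactWalk u m |H|<m ▹ oscillate u nb ,
      ▹-start (exactWalk u m |H|<m) refl , ▹-end (exactWalk u m |H|<m) ,
      ▹-ray (exactWalk u m |H|<m) refl (oscillate-ray eu)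
      where
      nb = proj₁ (neighbour u)
      eu = proj₂ (neighbour u)

module CycleFacts (M : Graph) (C : Cycle M) where
  open GraphFacts M
  open Sequences {V M}

  cycleEdge→edge : ∀ {x y} → CycleEdge C x y → Edge M x y
  cycleEdge→edge (i , j , succ , inj₁ (refl , refl)) = closed C i j succ
  cycleEdge→edge (i , j , succ , inj₂ (refl , refl)) = edge-sym (closed C i j succ)

  cycleEdge-sym : ∀ {x y} → CycleEdge C x y → CycleEdge C y x
  cycleEdge-sym (i , j , succ , inj₁ ends) = i , j , succ , inj₂ ends
  cycleEdge-sym (i , j , succ , inj₂ ends) = i , j , succ , inj₁ ends

  cycleEdge-on : ∀ {x y} → CycleEdge C x y → OnCycle C x
  cycleEdge-on (i , j , _ , inj₁ (xᵢ , _)) = i , xᵢ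
  cycleEdge-on (i , j , _ , inj₂ (_ , xⱼ)) = j , xⱼ

  onCycle? : ∀ v → Dec (OnCycle C v)
  onCycle? v = any? (λ i → vert C i ≟F v)

  cycleEdge? : ∀ x y → Dec (CycleEdge C x y)
  cycleEdge? x y = any? λ i → any? λ j → cyclicSucc? i j ×-dec
    (((vert C i ≟F x) ×-dec (vert C j ≟F y)) ⊎-dec ((vert C i ≟F y) ×-dec (vert C j ≟F x)))
    where
    cyclicSucc? : ∀ (i j : Fin (len C)) → Dec (CyclicSucc i j)
    cyclicSucc? i j = (toℕ j ≟ suc (toℕ i)) ⊎-dec ((toℕ i ≟ len C ∸ 1) ×-dec (toℕ j ≟ 0))

  -- The cycle vertex at position k (positions past the end are clamped).
  vertAt : ℕ → V M
  vertAt k with k <? len C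
  ... | yes k<len = vert C (fromℕ< k<len)
  ... | no _ = vert C (fromℕ< (<-≤-trans z<s (len≥3 C)))

  vertAt-toℕ : ∀ i → vertAt (toℕ i) ≡ vert C i
  vertAt-toℕ i with toℕ i <? len C
  ... | yes i<len = cong (vert C) (toℕ-injective (toℕ-fromℕ< i<len))
  ... | no i≮len = contradiction (toℕ<n i) i≮len

  vertAt-fromℕ< : ∀ {n} (n<len : n < len C) → vertAt n ≡ vert C (fromℕ< n<len)
  vertAt-fromℕ< n<len = trans (cong vertAt (≡-sym (toℕ-fromℕ< n<len))) (vertAt-toℕ (fromℕ< n<len))

  ascent : ∀ (j : Fin (len C)) → Steps (CycleEdge C) (toℕ j) vertAt
  ascent j k k<j =
    fromℕ< k<len , fromℕ< 1+k<len , inj₁ succ ,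
    inj₁ (≡-sym (vertAt-fromℕ< k<len) , ≡-sym (vertAt-fromℕ< 1+k<len))
    where
    1+k<len : suc k < len C
    1+k<len = <-≤-trans (s≤s k<j) (toℕ<n j)
    k<len : k < len C
    k<len = <-trans (n<1+n k) 1+k<len
    succ : toℕ (fromℕ< 1+k<len) ≡ suc (toℕ (fromℕ< k<len))
    succ = trans (toℕ-fromℕ< 1+k<len) (cong suc (≡-sym (toℕ-fromℕ< k<len)))

  cycleChain : ∀ i j → Chain (CycleEdge C) (vert C i) (vert C j)
  cycleChain i j = chain-++ (chain-map cycleEdge-sym (chain-reverse (fromZero i))) (fromZero j)
    where
    0<len = <-≤-trans z<s (len≥3 C)
    fromZero : ∀ j → Chain (CycleEdge C) (vert C (fromℕ< 0<len)) (vert C j)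
    fromZero j = chain (toℕ j) vertAt (vertAt-fromℕ< 0<len) (vertAt-toℕ j) (ascent j)

module Unicyclic (M : Graph) (C : Cycle M) (unique : UniqueCycle M C) where
  open GraphFacts M
  open Sequences {V M}
  open LoopErasure {V M} _≟F_
  open CycleFacts M C

  SameEnds : V M → V M → V M → V M → Set
  SameEnds x y a b = (a ≡ x × b ≡ y) ⊎ (a ≡ y × b ≡ x)

  Avoiding : V M → V M → V M → V M → Set
  Avoiding x y a b = Edge M a b × ¬ SameEnds x y a b

  -- An edge xy whose ends are joined by a path avoiding xy lies on C: after
  -- loop erasure the path has length at least 2 (length 0 or 1 would force
  -- x ≡ y or use xy itself), so with xy it forms a cycle, which must be C.
  closesCycle : ∀ {x y} → Edge M x y → Chain (Avoiding x y) y x → CycleEdge C x y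
  closesCycle {x} {y} exy (chain ℓ p p0 pℓ st) with erase {Avoiding x y} ℓ p st
  ... | zero , _ , start , end , _ =
        contradiction (trans (≡-sym (trans end pℓ)) (trans start p0)) (edge-irrefl exy)
  ... | suc zero , _ , start , end , st′ , _ =
        contradiction (inj₂ (trans start p0 , trans end pℓ)) (proj₂ (st′ 0 z<s))
  ... | suc (suc m) , p′ , start , end , st′ , distinct , _ =
        Equivalence.from (unique D x y)
          (subst₂ (CycleEdge D) (trans end pℓ) (trans start p0) (pathCycle-closing m p′ distinct edges closing))
    where
    edges : Steps (Edge M) (2 + m) p′
    edges i i<ℓ = proj₁ (st′ i i<ℓ)
    closing : Edge M (p′ (2 + m)) (p′ 0)
    closing = subst₂ (Edge M) (≡-sym (trans end pℓ)) (≡-sym (trans start p0)) exy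
    D : Cycle M
    D = pathCycle m p′ distinct edges closing

  bypassed : ∀ {R : V M → V M → Set} {x y} → (∀ {a b} → R a b → Edge M a b) →
    ¬ R x y → ¬ R y x → Edge M x y → Chain R y x → CycleEdge C x y
  bypassed {R} {x} {y} toEdge ¬Rxy ¬Ryx exy path = closesCycle exy (chain-map avoiding path)
    where
    avoiding : ∀ {a b} → R a b → Avoiding x y a b
    avoiding rab = toEdge rab , λ { (inj₁ (refl , refl)) → ¬Rxy rab ; (inj₂ (refl , refl)) → ¬Ryx rab }

  -- Components of M that miss C are trees; each gets the vertex of least index
  -- as its root.  Cycle vertices and roots together are the anchors, and the
  -- depth of a vertex is its distance to the anchors.
  ReachesCycle : V M → Set
  ReachesCycle v = ∃ λ i → Reach v (vert C i)

  Root : V M → Set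
  Root v = ¬ ReachesCycle v × (∀ w → Reach v w → toℕ v ≤ toℕ w)

  Anchor : V M → Set
  Anchor v = OnCycle C v ⊎ Root v

  anchor? : ∀ v → Dec (Anchor v)
  anchor? v = onCycle? v ⊎-dec
    (¬? (any? λ i → reach? v (vert C i)) ×-dec all? λ w → reach? v w →-dec (toℕ v ≤? toℕ w))

  root-misses-cycle : ∀ {s t} → Root s → Reach s t → ¬ OnCycle C t
  root-misses-cycle (misses , _) r (i , refl) = misses (i , r)

  roots-equal : ∀ {s t} → Root s → Root t → Reach s t → s ≡ t
  roots-equal (_ , leastₛ) (_ , leastₜ) r =
    toℕ-injective (≤-antisym (leastₛ _ r) (leastₜ _ (reach-sym r)))

  reachesRoot : ∀ v → ¬ ReachesCycle v → ∃ λ s → Root s × Reach v s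
  reachesRoot v misses with LeastNumber.least index? (v , refl , 0 , here)
    where
    index? : ∀ n → Dec (∃ λ w → toℕ w ≡ n × Reach v w)
    index? n = any? λ w → (toℕ w ≟ n) ×-dec reach? v w
  ... | _ , (s , refl , rvs) , minimal = s , (missesₛ , leastₛ) , rvs
    where
    missesₛ : ¬ ReachesCycle s
    missesₛ (i , rsc) = misses (i , reach-trans rvs rsc)
    leastₛ : ∀ w → Reach s w → toℕ s ≤ toℕ w
    leastₛ w rsw = ≮⇒≥ λ w<s → minimal (toℕ w) w<s (w , refl , reach-trans rvs rsw)

  reachesAnchor : ∀ v → ∃ λ ℓ → WalkTo Anchor ℓ v
  reachesAnchor v with any? (λ i → reach? v (vert C i))
  ... | yes (i , ℓ , w) = ℓ , vert C i , inj₁ (i , refl) , w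
  ... | no misses with reachesRoot v misses
  ...   | s , root , ℓ , w = ℓ , s , inj₂ root , w

  depthLeast : ∀ v → ∃ (LeastNumber.Least (λ ℓ → walkTo? anchor? ℓ v))
  depthLeast v = LeastNumber.least (λ ℓ → walkTo? anchor? ℓ v) (proj₂ (reachesAnchor v))

  depth : V M → ℕ
  depth v = proj₁ (depthLeast v)

  depth-walk : ∀ v → WalkTo Anchor (depth v) v
  depth-walk v = proj₁ (proj₂ (depthLeast v))

  depth-≤ : ∀ {v ℓ} → WalkTo Anchor ℓ v → depth v ≤ ℓ
  depth-≤ {v} {ℓ} w = ≮⇒≥ λ ℓ<depth → proj₂ (proj₂ (depthLeast v)) ℓ ℓ<depth w

  anchor : V M → V M
  anchor v = proj₁ (depth-walk v)

  anchor⇒depth≡0 : ∀ {v} → Anchor v → depth v ≡ 0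
  anchor⇒depth≡0 {v} av = n≤0⇒n≡0 (depth-≤ (v , av , here))

  depth≡0⇒anchor : ∀ {v} → depth v ≡ 0 → Anchor v
  depth≡0⇒anchor {v} d with depth-walk v
  ... | s , as , w with subst (Walk M v s) d w
  ...   | here = as

  depth-edge : ∀ {x y} → Edge M x y → depth x ≤ suc (depth y)
  depth-edge {x} {y} e with depth-walk y
  ... | s , as , w = depth-≤ (s , as , step e w)

  Down : V M → V M → Set
  Down a b = Edge M a b × depth a ≡ suc (depth b)

  -- A vertex of depth k + 1 has a neighbour of depth k: the next vertex on a
  -- shortest walk to the anchors.
  lowerNeighbour : ∀ {v k} → depth v ≡ suc k → ∃ λ u → Edge M v u × depth u ≡ k
  lowerNeighbour {v} d with depth-walk v
  ... | s , as , w with subst (Walk M v s) d w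
  ...   | step {y = u} e rest =
          u , e , ≤-antisym (depth-≤ (s , as , rest)) (≤-pred (subst (_≤ suc (depth u)) d (depth-edge e)))

  descent : ∀ v → ∃ λ s → Anchor s × Chain Down v s
  descent v = descend (depth v) v refl
    where
    descend : ∀ k v → depth v ≡ k → ∃ λ s → Anchor s × Chain Down v s
    descend zero v d = v , depth≡0⇒anchor d , chain-refl
    descend (suc k) v d with lowerNeighbour d
    ... | u , e , dᵤ with descend k u dᵤ
    ...   | s , as , path = s , as , chain-++ (chain-single (e , trans d (cong suc (≡-sym dᵤ)))) path

  Flat : V M → V M → Set
  Flat a b = Edge M a b × depth a ≡ 0 × depth b ≡ 0

  -- Connected anchors are joined at depth 0: two cycle vertices along C,
  -- and two roots only if they coincide.
  anchorsJoin : ∀ {s t} → Anchor s → Anchor t → Reach s t → Chain Flat s t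
  anchorsJoin (inj₁ (i , refl)) (inj₁ (j , refl)) _ = chain-map flat (cycleChain i j)
    where
    flat : ∀ {a b} → CycleEdge C a b → Flat a b
    flat ce = cycleEdge→edge ce , anchor⇒depth≡0 (inj₁ (cycleEdge-on ce)) ,
              anchor⇒depth≡0 (inj₁ (cycleEdge-on (cycleEdge-sym ce)))
  anchorsJoin (inj₁ onC) (inj₂ root) r = contradiction onC (root-misses-cycle root (reach-sym r))
  anchorsJoin (inj₂ root) (inj₁ onC) r = contradiction onC (root-misses-cycle root r)
  anchorsJoin (inj₂ rootₛ) (inj₂ rootₜ) r = subst (Chain Flat _) (roots-equal rootₛ rootₜ r) chain-refl

  Layered : V M → V M → Set
  Layered a b = Edge M a b × (depth a ≢ depth b ⊎ (depth a ≡ 0 × depth b ≡ 0))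

  -- Any two vertices in one component are joined by a layered chain: descend
  -- from both to the anchors and join these at depth 0.
  layeredChain : ∀ {x y} → Reach x y → Chain Layered x y
  layeredChain {x} {y} rxy with descent x | descent y
  ... | s , as , downₓ | t , at , downᵧ =
        chain-++ (chain-map down (downₓ))
          (chain-++ (chain-map flat (anchorsJoin as at rst)) (chain-map up (chain-reverse downᵧ)))
    where
    rst : Reach s t
    rst = reach-trans (reach-sym (chain→reach proj₁ downₓ)) (reach-trans rxy (chain→reach proj₁ downᵧ))
    down : ∀ {a b} → Down a b → Layered a b
    down (e , d) = e , inj₁ λ same → <-irrefl (≡-sym same) (subst (depth _ <_) (≡-sym d) ≤-refl)
    up : ∀ {a b} → Down b a → Layered a b
    up (e , d) = edge-sym e , inj₁ λ same → <-irrefl same (subst (depth _ <_) (≡-sym d) ≤-refl)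
    flat : ∀ {a b} → Flat a b → Layered a b
    flat (e , d₁ , d₂) = e , inj₂ (d₁ , d₂)

  -- An edge between two anchors lies on C: two roots are never adjacent, a
  -- root does not reach C, and an edge between cycle vertices that is not a
  -- cycle edge would be bypassed along C.
  anchorEdge-onCycle : ∀ {x y} → Anchor x → Anchor y → Edge M x y → CycleEdge C x y
  anchorEdge-onCycle {x} {y} (inj₁ (i , refl)) (inj₁ (j , refl)) exy with cycleEdge? x y
  ... | yes ce = ce
  ... | no ¬ce = bypassed cycleEdge→edge ¬ce (¬ce ∘ cycleEdge-sym) exy (cycleChain j i)
  anchorEdge-onCycle (inj₁ onC) (inj₂ root) exy =
    contradiction onC (root-misses-cycle root (reach-edge (edge-sym exy)))
  anchorEdge-onCycle (inj₂ root) (inj₁ onC) exy =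
    contradiction onC (root-misses-cycle root (reach-edge exy))
  anchorEdge-onCycle (inj₂ rootₓ) (inj₂ rootᵧ) exy =
    contradiction (roots-equal rootₓ rootᵧ (reach-edge exy)) (edge-irrefl exy)

  -- Every edge between vertices of equal depth lies on C.  At depth 0 both
  -- ends are anchors; at positive depth the edge is not layered but is
  -- bypassed by a layered chain.
  levelEdge-onCycle : ∀ {x y} → Edge M x y → depth x ≡ depth y → CycleEdge C x y
  levelEdge-onCycle {x} {y} exy dₓ≡dᵧ = byDepth (depth x) refl
    where
    byDepth : ∀ k → depth x ≡ k → CycleEdge C x y
    byDepth zero dₓ =
      anchorEdge-onCycle (depth≡0⇒anchor dₓ) (depth≡0⇒anchor (trans (≡-sym dₓ≡dᵧ) dₓ)) exy
    byDepth (suc k) dₓ =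
      bypassed proj₁ notLayered (notLayered ∘ swap) exy (layeredChain (reach-edge (edge-sym exy)))
      where
      notLayered : ¬ Layered x y
      notLayered (_ , inj₁ different) = different dₓ≡dᵧ
      notLayered (_ , inj₂ (d₀ , _)) = contradiction (trans (≡-sym dₓ) d₀) λ ()
      swap : Layered y x → Layered x y
      swap (e , inj₁ different) = edge-sym e , inj₁ (different ∘ ≡-sym)
      swap (e , inj₂ (d₁ , d₂)) = edge-sym e , inj₂ (d₂ , d₁)

  -- A vertex y of depth 1 has only one neighbour of depth 0, namely its anchor:
  -- another one, x, would be joined to the anchor at depth 0, and the edge xy
  -- would close a second cycle through y.
  uniqueParent : ∀ {x y} → Edge M x y → depth x ≡ 0 → depth y ≡ 1 → anchor y ≡ x
  uniqueParent {x} {y} exy dₓ dᵧ with depth-walk y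
  ... | s , as , w with subst (Walk M y s) dᵧ w
  ...   | step eys here with s ≟F x
  ...     | yes s≡x = s≡x
  ...     | no s≢x = contradiction (trans (≡-sym dᵧ) (anchor⇒depth≡0 (inj₁ yOnC))) λ ()
    where
    toAnchor : Avoiding x y y s
    toAnchor = eys , λ { (inj₁ (y≡x , _)) → edge-irrefl exy (≡-sym y≡x)
                       ; (inj₂ (_ , s≡x)) → s≢x s≡x }
    atDepth0 : ∀ {a b} → Flat a b → Avoiding x y a b
    atDepth0 (e , d₁ , d₂) = e , λ { (inj₁ (_ , refl)) → 1≢0 d₂ ; (inj₂ (refl , _)) → 1≢0 d₁ }
      where
      1≢0 : depth y ≢ 0
      1≢0 d = contradiction (trans (≡-sym dᵧ) d) λ ()
    yOnC : OnCycle C y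
    yOnC = cycleEdge-on (cycleEdge-sym (closesCycle exy (chain-++ (chain-single toAnchor)
             (chain-map atDepth0 (anchorsJoin as (depth≡0⇒anchor dₓ) (2 , step (edge-sym eys) (step (edge-sym exy) here)))))))

  depth-adjacent : ∀ {x y} → Edge M x y →
    depth x ≡ depth y ⊎ depth y ≡ suc (depth x) ⊎ depth x ≡ suc (depth y)
  depth-adjacent {x} {y} e with <-cmp (depth x) (depth y)
  ... | tri< dₓ<dᵧ _ _ = inj₂ (inj₁ (≤-antisym (depth-edge (edge-sym e)) dₓ<dᵧ))
  ... | tri≈ _ same _ = inj₁ same
  ... | tri> _ _ dᵧ<dₓ = inj₂ (inj₂ (≤-antisym (depth-edge e) dᵧ<dₓ))

  -- A vertex at distance r from C has depth r: its shortest walk to the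
  -- anchors cannot end in a root, since roots do not reach C.
  distance⇒depth : ∀ {v r} → DistToCycle v C r → depth v ≡ r
  distance⇒depth {v} {r} ((s , onC , w) , shortest) = ≤-antisym (depth-≤ (s , inj₁ onC , w)) r≤depth
    where
    r≤depth : r ≤ depth v
    r≤depth with depth-walk v
    ... | t , inj₁ onCₜ , wₜ = shortest t (depth v) onCₜ wₜ
    ... | t , inj₂ root , wₜ =
          contradiction onC (root-misses-cycle root (reach-trans (reach-sym (_ , wₜ)) (_ , w)))

  open CycleColouring (len C) (len≥3 C) using (colour; colour-proper)

  vertexColour : V M → Fin 3
  vertexColour v with onCycle? v
  ... | yes (i , _) = colour i
  ... | no _ = fzero

  vertexColour-vert : ∀ i → vertexColour (vert C i) ≡ colour i
  vertexColour-vert i with onCycle? (vert C i)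
  ... | yes (j , vⱼ≡vᵢ) = cong colour (distinct C vⱼ≡vᵢ)
  ... | no notOnC = contradiction (i , refl) notOnC

  cycleEdge-colours : ∀ {x y} → CycleEdge C x y → vertexColour x ≢ vertexColour y
  cycleEdge-colours (i , j , succ , inj₁ (refl , refl)) same =
    colour-proper i j succ (trans (≡-sym (vertexColour-vert i)) (trans same (vertexColour-vert j)))
  cycleEdge-colours (i , j , succ , inj₂ (refl , refl)) same =
    colour-proper i j succ (trans (≡-sym (vertexColour-vert i)) (trans (≡-sym same) (vertexColour-vert j)))

module Homomorphism (H : Graph) (tri : HasTriangle H)
                    (M : Graph) (C : Cycle M) (unique : UniqueCycle M C)
                    (q : ℕ → V H) (q-start : q 0 ≡ TriangleTarget.c H tri) (q-ray : GraphFacts.Ray H q)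
                    where
  open TriangleTarget H tri
  open GraphFacts H using (edge-sym)
  open CycleFacts M C using (cycleEdge-on; cycleEdge-sym)
  open Unicyclic M C unique

  atLevel : ℕ → V M → V H
  atLevel zero v = corner (vertexColour v)
  atLevel (suc zero) v = corner (other (vertexColour (anchor v)))
  atLevel (suc (suc k)) v = q k

  h : V M → V H
  h v = atLevel (depth v) v

  h-at : ∀ {v k} → depth v ≡ k → h v ≡ atLevel k v
  h-at {v} d = cong (λ k → atLevel k v) d

  -- Edges within a level lie on C at depth 0 and are properly coloured.
  levelEdge : ∀ {x y} → Edge M x y → depth x ≡ depth y → Edge H (h x) (h y)
  levelEdge exy same =
    subst₂ (Edge H) (≡-sym (h-at dₓ)) (≡-sym (h-at dᵧ)) (corner-edge _ _ (cycleEdge-colours ce))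
    where
    ce = levelEdge-onCycle exy same
    dₓ = anchor⇒depth≡0 (inj₁ (cycleEdge-on ce))
    dᵧ = anchor⇒depth≡0 (inj₁ (cycleEdge-on (cycleEdge-sym ce)))

  upEdgeAt : ∀ k {x y} → Edge M x y → depth x ≡ k → depth y ≡ suc k →
             Edge H (atLevel k x) (atLevel (suc k) y)
  upEdgeAt zero {x} exy dₓ dᵧ =
    subst (λ p → Edge H (corner (vertexColour x)) (corner (other (vertexColour p))))
      (≡-sym (uniqueParent exy dₓ dᵧ)) (corner-edge _ _ (other-≢ (vertexColour x) ∘ ≡-sym))
  upEdgeAt (suc zero) {x} _ _ _ =
    subst (Edge H _) (≡-sym q-start) (corner-edge _ two (other-≢-two (vertexColour (anchor x))))
  upEdgeAt (suc (suc k)) _ _ _ = q-ray k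

  upEdge : ∀ {x y} → Edge M x y → depth y ≡ suc (depth x) → Edge H (h x) (h y)
  upEdge {x} exy dᵧ = subst (Edge H (h x)) (≡-sym (h-at dᵧ)) (upEdgeAt (depth x) exy refl dᵧ)

  -- h is a homomorphism, because every edge is level or goes up or down one level.
  h-hom : ∀ x y → Edge M x y → Edge H (h x) (h y)
  h-hom x y exy with depth-adjacent exy
  ... | inj₁ same = levelEdge exy same
  ... | inj₂ (inj₁ up) = upEdge exy up
  ... | inj₂ (inj₂ down) = edge-sym (upEdge (GraphFacts.edge-sym M exy) down)

-- Lemma 1.1.  Write r = m + 2 with m > |V H|; take a ray from c that is at u
-- at time m, and build the homomorphism above.  Vertices at distance r from C
-- have depth r, so they are mapped to q m = u.
lemma11 : (H : Graph) → Connected H → HasTriangle H → (u : V H) →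
          (M : Graph) → (C : Cycle M) → UniqueCycle M C →
          (r : ℕ) → size H + 3 ≤ r →
          Σ (V M → V H) (λ h →
            (∀ x y → Edge M x y → Edge H (h x) (h y)) ×
            (∀ v → DistToCycle v C r → h v ≡ u))
lemma11 H conn tri u M C unique r |H|+3≤r with TriangleTarget.rayThrough H tri conn u (r ∸ 2) |H|<r∸2
  where
  |H|<r∸2 : size H < r ∸ 2
  |H|<r∸2 = subst (_≤ r ∸ 2) (trans (+-∸-assoc (size H) (s≤s (s≤s z≤n))) (+-comm (size H) 1))
              (∸-monoˡ-≤ 2 |H|+3≤r)
... | q , q-start , q-at-u , q-ray = h , h-hom , mapsToU
  where
  open Homomorphism H tri M C unique q q-start q-ray
  r≡2+[r∸2] : r ≡ 2 + (r ∸ 2)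
  r≡2+[r∸2] = ≡-sym (m+[n∸m]≡n (≤-trans (n≤1+n 2) (≤-trans (m≤n+m 3 (size H)) |H|+3≤r)))
  mapsToU : ∀ v → DistToCycle v C r → h v ≡ u
  mapsToU v dist = trans (h-at (trans (Unicyclic.distance⇒depth M C unique dist) r≡2+[r∸2])) q-at-u
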